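{- Let $\mathscr{P}$, $\mathscr{N}$, $\mathscr{L}$ be the infinite lower triangular matrices with entries, for $n\ge k\ge 0$, $$\mathscr{P}_{n,k}=\binom{n}{k},\qquad \mathscr{N}_{n,k}=\frac{1}{n+1}\binom{n+1}{k+1}\binom{n+1}{k},\qquad \mathscr{L}_{n,k}=\binom{n}{k}\frac{(n+1)!}{(k+1)!},$$ and $0$ for $k>n$. Then for every integer $j\ge 1$, the matrices $\mathscr{P}_{[j]}$, $\mathscr{N}_{[j]}$, $\mathscr{L}_{[j]}$ all belong to $SDR_\infty$.
   Context: All matrices are infinite lower triangular matrices $\mathscr{A}=(A_{n,k})_{n\ge k\ge 0}$ with complex entries; we set $A_{n,k}=0$ whenever $k>n$. For an integer $m\ge 3$, $\mathscr{A}$ is called an SDR-matrix of order $m$ (written $\mathscr{A}\in SDR_m$) if for all integers $n,k\ge 0$, all $2\le p\le m-1$ and all $0\le r\le p-1$, $$\prod_{i=0}^{r}A_{n+i,k+r-i}\prod_{i=0}^{p-r-1}A_{n+p-i,k+r+i+1}=\prod_{i=0}^{r}A_{n+p-i,k+p-r+i}\prod_{i=0}^{p-r-1}A_{n+i,k+p-r-i-1}.$$ $SDR_\infty$ denotes the set of matrices lying in $SDR_m$ for every $m\ge 3$. For an integer $j\ge 1$, $\mathscr{A}_{[j]}=(A^{[j]}_{n,k})_{n\ge k\ge 0}$ is the lower triangular matrix with $A^{[j]}_{n,k}=\det\big(A_{n+s,k+t}\big)_{0\le s,t\le j-1}$ for $n\ge k\ge 0$ (the $j\times j$ determinant of the block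 with rows $n,\dots,n+j-1$ and columns $k,\dots,k+j-1$, using $A_{n,k}=0$ for $k>n$). -}

module Defs where

open import Data.Nat as ℕ using (ℕ; zero; suc; _≤_; _∸_; _≤?_)
open import Data.Nat.Combinatorics using (_C_)
open import Data.Nat using (_!)
open import Data.Nat.Properties using (_!≢0)
open import Data.Integer as ℤ using (ℤ; +_)
open import Data.Fin using (Fin; zero; suc; toℕ; punchIn)
open import Relation.Nullary using (yes; no)

-- An infinite lower triangular matrix, given by its entry function
-- (n , k) ↦ A n k.  Lower triangularity (A n k = 0 for k > n) is built
-- into each concrete matrix below via `lowerTri`.
Matrix : Set
Matrix = ℕ → ℕ → ℤ

lowerTri : (ℕ → ℕ → ℤ) → Matrix
lowerTri f n k with k ≤? n
... | yes _ = f n k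
... | no  _ = + 0

prodTo : ℕ → (ℕ → ℤ) → ℤ
prodTo zero    f = + 1
prodTo (suc c) f = prodTo c f ℤ.* f c

sumFin : ∀ {j} → (Fin j → ℤ) → ℤ
sumFin {zero}  f = + 0
sumFin {suc j} f = f zero ℤ.+ sumFin (λ i → f (suc i))

sign : ℕ → ℤ
sign zero          = + 1
sign (suc zero)    = ℤ.- (+ 1)
sign (suc (suc i)) = sign i

det : ∀ j → (Fin j → Fin j → ℤ) → ℤ
det zero    M = + 1
det (suc j) M =
  sumFin (λ (c : Fin (suc j)) →
    sign (toℕ c) ℤ.* M zero c ℤ.* det j (λ s t → M (suc s) (punchIn c t)))

SDR : ℕ → Matrix → Set
SDR m A =
  ∀ (n k p r : ℕ) → 2 ≤ p → p ≤ m ∸ 1 → r ≤ p ∸ 1 →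
    prodTo (suc r) (λ i → A (n ℕ.+ i) (k ℕ.+ r ∸ i))
      ℤ.* prodTo (p ∸ r) (λ i → A (n ℕ.+ p ∸ i) (k ℕ.+ r ℕ.+ i ℕ.+ 1))
    ≡ prodTo (suc r) (λ i → A (n ℕ.+ p ∸ i) (k ℕ.+ p ∸ r ℕ.+ i))
      ℤ.* prodTo (p ∸ r) (λ i → A (n ℕ.+ i) (k ℕ.+ p ∸ r ∸ i ∸ 1))
  where open import Relation.Binary.PropositionalEquality using (_≡_)

SDR∞ : Matrix → Set
SDR∞ A = ∀ (m : ℕ) → 3 ≤ m → SDR m A

minorMatrix : ℕ → Matrix → Matrix
minorMatrix j A = lowerTri (λ n k → det j (λ s t → A (n ℕ.+ toℕ s) (k ℕ.+ toℕ t)))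

𝒫 : Matrix
𝒫 = lowerTri (λ n k → + (n C k))

-- Narayana matrix  N_{n,k} = C(n+1,k+1) C(n+1,k) / (n+1)   (exact division)
𝒩 : Matrix
𝒩 = lowerTri (λ n k → + (((suc n C suc k) ℕ.* (suc n C k)) ℕ./ suc n))

-- L_{n,k} = C(n,k) (n+1)! / (k+1)!   (exact division for k ≤ n)
ℒ : Matrix
ℒ = lowerTri (λ n k → + ((n C k) ℕ.* ℕ._/_ ((suc n) !) ((suc k) !) {{(suc k) !≢0}}))

module Submission where

open import Defs
open import Data.Nat using (ℕ; _≤_)
open import Data.Product using (_×_)

-- A matrix with A n k · X k · Y (n − k) = R n · W (n − k), X and Y nowhere zero, satisfies
-- every SDR identity: the identities are multiplicative in A, and they hold for matrices that
-- depend only on the row, only on the column or only on the diagonal n − k, because the two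
-- sides of an identity visit the same rows, the same columns and the same diagonals.
-- If A n k = α n / (β k γ (n − k)) on and below the diagonal, scaling the rows and columns of
-- a j × j minor shows that A_[j] has such a factorisation, with W (d) the determinant of the
-- quotients γ (d + s) / γ (d + s − t). The matrices 𝒫, 𝒩, ℒ are of this kind with
-- (α, β, γ) = (n!, k!, e!), (n! (n+1)!, k! (k+1)!, e! (e+1)!), (n! (n+1)!, k! (k+1)!, e!).

-- Factorial forms of the binomial, Narayana and Lah numbers

module Factorials where
  open import Data.Nat.Base using (suc; _+_; _*_; _∸_; s≤s; _!)
  open import Data.Nat.Properties
  open import Data.Nat.Combinatorics using (_C_; _P_; nCk≡n!/k![n-k]!; k![n∸k]!∣n!; nPk≡n!/[n∸k]!)
  open import Data.Nat.DivMod using (_/_; m/n*n≡m)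
  open import Data.Nat.Divisibility using (_∣_; divides; n∣m*n; ∣m+n∣m⇒∣n; m≤n⇒m!∣n!)
  open import Relation.Binary.PropositionalEquality
  import Data.Nat.Tactic.RingSolver as ℕ-Solver
  open ≡-Reasoning

  nCk*k!*[n∸k]!≡n! : ∀ {n k} → k ≤ n → (n C k) * (k ! * (n ∸ k) !) ≡ n !
  nCk*k!*[n∸k]!≡n! {n} {k} k≤n =
    trans (cong (_* (k ! * (n ∸ k) !)) (nCk≡n!/k![n-k]! k≤n))
          (m/n*n≡m {{k !* (n ∸ k) !≢0}} (k![n∸k]!∣n! k≤n))

  [1+n]Ck*k!*[1+n∸k]!≡[1+n]! : ∀ {n k} → k ≤ n → (suc n C k) * (k ! * suc (n ∸ k) !) ≡ suc n !
  [1+n]Ck*k!*[1+n∸k]!≡[1+n]! {n} {k} k≤n =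
    trans (cong (λ m → (suc n C k) * (k ! * m !)) (sym (+-∸-assoc 1 k≤n)))
          (nCk*k!*[n∸k]!≡n! (m≤n⇒m≤1+n k≤n))

  nPk*[n∸k]!≡n! : ∀ {n k} → k ≤ n → (n P k) * (n ∸ k) ! ≡ n !
  nPk*[n∸k]!≡n! {n} {k} k≤n =
    trans (cong (_* (n ∸ k) !) (nPk≡n!/[n∸k]! k≤n))
          (m/n*n≡m {{(n ∸ k) !≢0}} (m≤n⇒m!∣n! (m∸n≤m n k)))

  private
    x*k![n∸k]!≡[1+n]!⇒x≡[1+n]*nCk : ∀ {n k} x → k ≤ n →
      x * (k ! * (n ∸ k) !) ≡ suc n ! → x ≡ suc n * (n C k)
    x*k![n∸k]!≡[1+n]!⇒x≡[1+n]*nCk {n} {k} x k≤n eq =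
      *-cancelʳ-≡ x (suc n * (n C k)) (k ! * (n ∸ k) !) {{k !* (n ∸ k) !≢0}} (begin
        x * (k ! * (n ∸ k) !)                  ≡⟨ eq ⟩
        suc n * n !                            ≡⟨ cong (suc n *_) (nCk*k!*[n∸k]!≡n! k≤n) ⟨
        suc n * ((n C k) * (k ! * (n ∸ k) !))  ≡⟨ *-assoc (suc n) (n C k) _ ⟨
        suc n * (n C k) * (k ! * (n ∸ k) !)    ∎)

  [1+n]C[1+k]*[1+k]≡[1+n]*nCk : ∀ {n k} → k ≤ n → (suc n C suc k) * suc k ≡ suc n * (n C k)
  [1+n]C[1+k]*[1+k]≡[1+n]*nCk {n} {k} k≤n = x*k![n∸k]!≡[1+n]!⇒x≡[1+n]*nCk _ k≤n (begin
    (suc n C suc k) * suc k * (k ! * (n ∸ k) !)  ≡⟨ reassoc (suc n C suc k) (suc k) (k !) ((n ∸ k) !) ⟩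
    (suc n C suc k) * (suc k ! * (n ∸ k) !)      ≡⟨ nCk*k!*[n∸k]!≡n! (s≤s k≤n) ⟩
    suc n !                                      ∎)
    where
    reassoc : ∀ a b c d → a * b * (c * d) ≡ a * (b * c * d)
    reassoc = ℕ-Solver.solve-∀

  [1+n]Ck*[1+n∸k]≡[1+n]*nCk : ∀ {n k} → k ≤ n → (suc n C k) * suc (n ∸ k) ≡ suc n * (n C k)
  [1+n]Ck*[1+n∸k]≡[1+n]*nCk {n} {k} k≤n = x*k![n∸k]!≡[1+n]!⇒x≡[1+n]*nCk _ k≤n (begin
    (suc n C k) * suc (n ∸ k) * (k ! * (n ∸ k) !)
      ≡⟨ reassoc (suc n C k) (suc (n ∸ k)) (k !) ((n ∸ k) !) ⟩
    (suc n C k) * (k ! * suc (n ∸ k) !)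
      ≡⟨ [1+n]Ck*k!*[1+n∸k]!≡[1+n]! k≤n ⟩
    suc n !
      ∎)
    where
    reassoc : ∀ a b c d → a * b * (c * d) ≡ a * (c * (b * d))
    reassoc = ℕ-Solver.solve-∀

  -- Adding the two absorption identities gives P (n + 2) = (n + 1) (C₁ + C₂) (n C k),
  -- so n + 1 divides P (n + 1) + P and hence P.
  [1+n]∣[1+n]C[1+k]*[1+n]Ck : ∀ {n k} → k ≤ n → suc n ∣ (suc n C suc k) * (suc n C k)
  [1+n]∣[1+n]C[1+k]*[1+n]Ck {n} {k} k≤n = ∣m+n∣m⇒∣n (divides (C₂ * c + C₁ * c) P[n+2]) (n∣m*n P)
    where
    C₁ = suc n C suc k
    C₂ = suc n C k
    c  = n C k
    P  = C₁ * C₂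
    split : ∀ C₁ C₂ k l →
      C₁ * C₂ * suc (k + l) + C₁ * C₂ ≡ C₂ * (C₁ * suc k) + C₁ * (C₂ * suc l)
    split = ℕ-Solver.solve-∀
    collect : ∀ C₁ C₂ c m → C₂ * (m * c) + C₁ * (m * c) ≡ (C₂ * c + C₁ * c) * m
    collect = ℕ-Solver.solve-∀
    P[n+2] : P * suc n + P ≡ (C₂ * c + C₁ * c) * suc n
    P[n+2] = begin
      P * suc n + P                                ≡⟨ cong (λ m → P * suc m + P) (m+[n∸m]≡n k≤n) ⟨
      P * suc (k + (n ∸ k)) + P                    ≡⟨ split C₁ C₂ k (n ∸ k) ⟩
      C₂ * (C₁ * suc k) + C₁ * (C₂ * suc (n ∸ k))  ≡⟨ cong₂ (λ x y → C₂ * x + C₁ * y)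
                                                            ([1+n]C[1+k]*[1+k]≡[1+n]*nCk k≤n)
                                                            ([1+n]Ck*[1+n∸k]≡[1+n]*nCk k≤n) ⟩
      C₂ * (suc n * c) + C₁ * (suc n * c)          ≡⟨ collect C₁ C₂ c (suc n) ⟩
      (C₂ * c + C₁ * c) * suc n                    ∎

  narayana : ℕ → ℕ → ℕ
  narayana n k = ((suc n C suc k) * (suc n C k)) / suc n

  narayana-factorial : ∀ {n k} → k ≤ n →
    narayana n k * ((k ! * suc k !) * ((n ∸ k) ! * suc (n ∸ k) !)) ≡ n ! * suc n !
  narayana-factorial {n} {k} k≤n = *-cancelʳ-≡ _ _ (suc n) (begin
    narayana n k * F * suc n
      ≡⟨ swap (narayana n k) F (suc n) ⟩
    narayana n k * suc n * F
      ≡⟨ cong (_* F) (m/n*n≡m ([1+n]∣[1+n]C[1+k]*[1+n]Ck k≤n)) ⟩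
    C₁ * C₂ * F
      ≡⟨ regroup C₁ C₂ (k !) (suc k !) ((n ∸ k) !) (suc (n ∸ k) !) ⟩
    C₁ * (suc k ! * (n ∸ k) !) * (C₂ * (k ! * suc (n ∸ k) !))
      ≡⟨ cong₂ _*_ (nCk*k!*[n∸k]!≡n! (s≤s k≤n)) ([1+n]Ck*k!*[1+n∸k]!≡[1+n]! k≤n) ⟩
    suc n * n ! * suc n !
      ≡⟨ rotate (suc n) (n !) (suc n !) ⟩
    n ! * suc n ! * suc n
      ∎)
    where
    C₁ = suc n C suc k
    C₂ = suc n C k
    F  = (k ! * suc k !) * ((n ∸ k) ! * suc (n ∸ k) !)
    swap : ∀ a b c → a * b * c ≡ a * c * b
    swap = ℕ-Solver.solve-∀
    regroup : ∀ C₁ C₂ a b c d → C₁ * C₂ * ((a * b) * (c * d)) ≡ C₁ * (b * c) * (C₂ * (a * d))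
    regroup = ℕ-Solver.solve-∀
    rotate : ∀ a b c → a * b * c ≡ b * c * a
    rotate = ℕ-Solver.solve-∀

  lah : ℕ → ℕ → ℕ
  lah n k = (n C k) * _/_ (suc n !) (suc k !) {{suc k !≢0}}

  lah-factorial : ∀ {n k} → k ≤ n → lah n k * ((k ! * suc k !) * (n ∸ k) !) ≡ n ! * suc n !
  lah-factorial {n} {k} k≤n = begin
    (n C k) * q * ((k ! * suc k !) * (n ∸ k) !)
      ≡⟨ regroup (n C k) q (k !) (suc k !) ((n ∸ k) !) ⟩
    (n C k) * (k ! * (n ∸ k) !) * (q * suc k !)
      ≡⟨ cong₂ _*_ (nCk*k!*[n∸k]!≡n! k≤n) (m/n*n≡m {{suc k !≢0}} (m≤n⇒m!∣n! (s≤s k≤n))) ⟩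
    n ! * suc n !
      ∎
    where
    q = _/_ (suc n !) (suc k !) {{suc k !≢0}}
    regroup : ∀ C q a b c → C * q * ((a * b) * c) ≡ C * (a * c) * (q * b)
    regroup = ℕ-Solver.solve-∀

  nPk*[1+n]Pk*[n∸k]!*[1+n∸k]!≡n!*[1+n]! : ∀ {n k} → k ≤ n →
    ((n P k) * (suc n P k)) * ((n ∸ k) ! * suc (n ∸ k) !) ≡ n ! * suc n !
  nPk*[1+n]Pk*[n∸k]!*[1+n∸k]!≡n!*[1+n]! {n} {k} k≤n = begin
    ((n P k) * (suc n P k)) * ((n ∸ k) ! * suc (n ∸ k) !)
      ≡⟨ interchange (n P k) (suc n P k) ((n ∸ k) !) (suc (n ∸ k) !) ⟩
    ((n P k) * (n ∸ k) !) * ((suc n P k) * suc (n ∸ k) !)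
      ≡⟨ cong (λ m → ((n P k) * (n ∸ k) !) * ((suc n P k) * m !)) (+-∸-assoc 1 k≤n) ⟨
    ((n P k) * (n ∸ k) !) * ((suc n P k) * (suc n ∸ k) !)
      ≡⟨ cong₂ _*_ (nPk*[n∸k]!≡n! k≤n) (nPk*[n∸k]!≡n! (m≤n⇒m≤1+n k≤n)) ⟩
    n ! * suc n !
      ∎
    where
    interchange : ∀ a b c d → (a * b) * (c * d) ≡ (a * c) * (b * d)
    interchange = ℕ-Solver.solve-∀

open Factorials

open import Data.Nat.Base as ℕ using (zero; suc; _+_; _∸_; _<_; _!)
import Data.Nat.Properties as ℕ
open import Data.Nat.Properties using (_!≢0; _!*_!≢0)
open import Data.Nat.Combinatorics using (_C_; _P_; k>n⇒nPk≡0)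
open import Data.Integer.Base as ℤ using (ℤ; +_; -[1+_]; 0ℤ; 1ℤ; _*_; _⊖_; -_; NonZero)
import Data.Integer.Properties as ℤ
open import Data.Fin.Base using (Fin; zero; suc; toℕ; punchIn)
open import Data.Product using (∃; _,_)
open import Data.Sum using (inj₁; inj₂)
open import Relation.Nullary using (yes; no; contradiction)
open import Relation.Binary.PropositionalEquality
open import Algebra.Properties.CommutativeSemigroup ℤ.*-commutativeSemigroup using (interchange)
open import Algebra.Properties.CommutativeMonoid.Sum ℤ.*-1-commutativeMonoid
  using (sum-remove) renaming (sum to ∏)
import Data.Nat.Tactic.RingSolver as ℕ-Solver
import Data.Integer.Tactic.RingSolver as ℤ-Solver
open ≡-Reasoning

[m+n]∸[n∸o]≡m+o : ∀ m {n o} → o ≤ n → m + n ∸ (n ∸ o) ≡ m + o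
[m+n]∸[n∸o]≡m+o m {n} {o} o≤n =
  trans (ℕ.+-∸-assoc m (ℕ.m∸n≤m n o)) (cong (_+_ m) (ℕ.m∸[m∸n]≡n o≤n))

[1+m+n]∸m≡1+n : ∀ m n → suc (m + n) ∸ m ≡ suc n
[1+m+n]∸m≡1+n m n = trans (ℕ.+-∸-assoc 1 (ℕ.m≤m+n m n)) (cong suc (ℕ.m+n∸m≡n m n))

m+q≡o+n⇒m⊖n≡o⊖q : ∀ {m n o q} → m + q ≡ o + n → m ⊖ n ≡ o ⊖ q
m+q≡o+n⇒m⊖n≡o⊖q {m} {n} {o} {q} m+q≡o+n = begin
  m ⊖ n              ≡⟨ ℤ.+-cancelˡ-⊖ q m n ⟨
  (q + m) ⊖ (q + n)  ≡⟨ cong₂ _⊖_ (trans (ℕ.+-comm q m) (trans m+q≡o+n (ℕ.+-comm o n)))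
                                  (ℕ.+-comm q n) ⟩
  (n + o) ⊖ (n + q)  ≡⟨ ℤ.+-cancelˡ-⊖ n o q ⟩
  o ⊖ q              ∎

[m+n]⊖m≡n : ∀ m n → (m + n) ⊖ m ≡ + n
[m+n]⊖m≡n m n = trans (ℤ.≤-⊖ (ℕ.m≤m+n m n)) (cong +_ (ℕ.m+n∸m≡n m n))

m<n⇒⊖-negative : ∀ {m n} → m < n → ∃ λ x → m ⊖ n ≡ -[1+ x ]
m<n⇒⊖-negative {m} m<n with ℕ.m≤n⇒∃[o]m+o≡n m<n
... | x , refl = x , trans (ℤ.⊖-< m<n) (cong (λ z → - (+ z)) [1+m+x]∸m≡1+x)
  where
  [1+m+x]∸m≡1+x : suc m + x ∸ m ≡ suc x
  [1+m+x]∸m≡1+x = trans (cong (_∸ m) (sym (ℕ.+-suc m x))) (ℕ.m+n∸m≡n m (suc x))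

lowerTri-≤ : ∀ f {n k} → k ≤ n → lowerTri f n k ≡ f n k
lowerTri-≤ f {n} {k} k≤n with k ℕ.≤? n
... | yes _   = refl
... | no  k≰n = contradiction k≤n k≰n

lowerTri-> : ∀ f {n k} → n < k → lowerTri f n k ≡ 0ℤ
lowerTri-> f {n} {k} n<k with k ℕ.≤? n
... | yes k≤n = contradiction k≤n (ℕ.<⇒≱ n<k)
... | no  _   = refl

prodTo-cong : ∀ c {f g : ℕ → ℤ} → (∀ i → i < c → f i ≡ g i) → prodTo c f ≡ prodTo c g
prodTo-cong zero    f≗g = refl
prodTo-cong (suc c) f≗g =
  cong₂ _*_ (prodTo-cong c (λ i i<c → f≗g i (ℕ.m<n⇒m<1+n i<c))) (f≗g c (ℕ.n<1+n c))

prodTo-* : ∀ c (f g : ℕ → ℤ) → prodTo c (λ i → f i * g i) ≡ prodTo c f * prodTo c g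
prodTo-* zero    f g = refl
prodTo-* (suc c) f g =
  trans (cong (_* (f c * g c)) (prodTo-* c f g)) (interchange (prodTo c f) (prodTo c g) (f c) (g c))

prodTo-nonZero : ∀ c {f : ℕ → ℤ} → (∀ i → NonZero (f i)) → NonZero (prodTo c f)
prodTo-nonZero zero    _   = _
prodTo-nonZero (suc c) {f} f≢0 = ℤ.i*j≢0 (prodTo c f) (f c) {{prodTo-nonZero c f≢0}} {{f≢0 c}}

prodTo-reverse : ∀ c (f : ℕ → ℤ) → prodTo c f ≡ prodTo c (λ i → f (c ∸ suc i))
prodTo-reverse zero    f = refl
prodTo-reverse (suc c) f = begin
  prodTo c f * f c                      ≡⟨ ℤ.*-comm (prodTo c f) (f c) ⟩
  f c * prodTo c f                      ≡⟨ cong (f c *_) (prodTo-reverse c f) ⟩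
  f c * prodTo c (λ i → f (c ∸ suc i))  ≡⟨ prodTo-first c (λ i → f (c ∸ i)) ⟨
  prodTo (suc c) (λ i → f (c ∸ i))      ∎
  where
  prodTo-first : ∀ c (g : ℕ → ℤ) → prodTo (suc c) g ≡ g 0 * prodTo c (λ i → g (suc i))
  prodTo-first zero    g = ℤ.*-comm 1ℤ (g 0)
  prodTo-first (suc c) g = trans (cong (_* g (suc c)) (prodTo-first c g)) (ℤ.*-assoc (g 0) _ _)

prodTo-+ : ∀ n a b (f : ℕ → ℤ) →
  prodTo (a + b) (λ i → f (n + i)) ≡ prodTo a (λ i → f (n + i)) * prodTo b (λ i → f (n + a + i))
prodTo-+ n a zero    f =
  trans (cong (λ c → prodTo c (λ i → f (n + i))) (ℕ.+-identityʳ a)) (sym (ℤ.*-identityʳ _))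
prodTo-+ n a (suc b) f = begin
  prodTo (a + suc b) (λ i → f (n + i))
    ≡⟨ cong (λ c → prodTo c (λ i → f (n + i))) (ℕ.+-suc a b) ⟩
  prodTo (a + b) (λ i → f (n + i)) * f (n + (a + b))
    ≡⟨ cong₂ _*_ (prodTo-+ n a b f) (cong f (sym (ℕ.+-assoc n a b))) ⟩
  front * back * f (n + a + b)
    ≡⟨ ℤ.*-assoc front back (f (n + a + b)) ⟩
  front * (back * f (n + a + b))
    ∎
  where
  front = prodTo a (λ i → f (n + i))
  back  = prodTo b (λ i → f (n + a + i))

prodTo-swap : ∀ n a b (f : ℕ → ℤ) →
  prodTo a (λ i → f (n + i)) * prodTo b (λ i → f (n + a + i))
  ≡ prodTo a (λ i → f (n + b + i)) * prodTo b (λ i → f (n + i))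
prodTo-swap n a b f = begin
  prodTo a (λ i → f (n + i)) * prodTo b (λ i → f (n + a + i))
    ≡⟨ prodTo-+ n a b f ⟨
  prodTo (a + b) (λ i → f (n + i))
    ≡⟨ cong (λ c → prodTo c (λ i → f (n + i))) (ℕ.+-comm a b) ⟩
  prodTo (b + a) (λ i → f (n + i))
    ≡⟨ prodTo-+ n b a f ⟩
  prodTo b (λ i → f (n + i)) * prodTo a (λ i → f (n + b + i))
    ≡⟨ ℤ.*-comm (prodTo b (λ i → f (n + i))) _ ⟩
  prodTo a (λ i → f (n + b + i)) * prodTo b (λ i → f (n + i))
    ∎

prodTo-countdown : ∀ {a} s c (f : ℕ → ℤ) → a ≡ s + c →
  prodTo (suc c) (λ i → f (a ∸ i)) ≡ prodTo (suc c) (λ i → f (s + i))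
prodTo-countdown s c f refl =
  trans (prodTo-reverse (suc c) _)
        (prodTo-cong (suc c) (λ i i<1+c → cong f ([m+n]∸[n∸o]≡m+o s (ℕ.≤-pred i<1+c))))

-- SDR identities as products along zigzags

record Zigzag : Set where
  field
    length₁ length₂     : ℕ
    row₁ col₁ row₂ col₂ : ℕ → ℕ

prodAlong : Zigzag → Matrix → ℤ
prodAlong Z A =
  prodTo length₁ (λ i → A (row₁ i) (col₁ i)) * prodTo length₂ (λ i → A (row₂ i) (col₂ i))
  where open Zigzag Z

-- SDR m A unfolds to: prodAlong (sdrLHS n k p r) A ≡ prodAlong (sdrRHS n k p r) A
sdrLHS sdrRHS : (n k p r : ℕ) → Zigzag
sdrLHS n k p r = record
  { length₁ = suc r ; row₁ = λ i → n + i     ; col₁ = λ i → k + r ∸ i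
  ; length₂ = p ∸ r ; row₂ = λ i → n + p ∸ i ; col₂ = λ i → k + r + i + 1 }
sdrRHS n k p r = record
  { length₁ = suc r ; row₁ = λ i → n + p ∸ i ; col₁ = λ i → k + p ∸ r + i
  ; length₂ = p ∸ r ; row₂ = λ i → n + i     ; col₂ = λ i → k + p ∸ r ∸ i ∸ 1 }

_⊙_ : Matrix → Matrix → Matrix
(A ⊙ B) n k = A n k * B n k

prodAlong-⊙ : ∀ Z A B → prodAlong Z (A ⊙ B) ≡ prodAlong Z A * prodAlong Z B
prodAlong-⊙ Z A B = trans
  (cong₂ _*_ (prodTo-* length₁ (entry₁ A) (entry₁ B)) (prodTo-* length₂ (entry₂ A) (entry₂ B)))
  (interchange (prodTo length₁ (entry₁ A)) (prodTo length₁ (entry₁ B))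
               (prodTo length₂ (entry₂ A)) (prodTo length₂ (entry₂ B)))
  where
  open Zigzag Z
  entry₁ entry₂ : Matrix → ℕ → ℤ
  entry₁ M i = M (row₁ i) (col₁ i)
  entry₂ M i = M (row₂ i) (col₂ i)

prodAlong-cong : ∀ Z {A B} → (∀ n k → A n k ≡ B n k) → prodAlong Z A ≡ prodAlong Z B
prodAlong-cong Z A≗B =
  cong₂ _*_ (prodTo-cong length₁ (λ i _ → A≗B _ _)) (prodTo-cong length₂ (λ i _ → A≗B _ _))
  where open Zigzag Z

prodAlong-nonZero : ∀ Z {A} → (∀ n k → NonZero (A n k)) → NonZero (prodAlong Z A)
prodAlong-nonZero Z {A} A≢0 =
  ℤ.i*j≢0 (prodTo length₁ (λ i → A (row₁ i) (col₁ i)))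
          (prodTo length₂ (λ i → A (row₂ i) (col₂ i)))
          {{prodTo-nonZero length₁ (λ i → A≢0 _ _)}} {{prodTo-nonZero length₂ (λ i → A≢0 _ _)}}
  where open Zigzag Z

SDR-cong : ∀ {m A B} → (∀ n k → A n k ≡ B n k) → SDR m A → SDR m B
SDR-cong {A = A} {B} A≗B sdrA n k p r 2≤p p<m r<p = begin
  prodAlong (sdrLHS n k p r) B  ≡⟨ prodAlong-cong (sdrLHS n k p r) A≗B ⟨
  prodAlong (sdrLHS n k p r) A  ≡⟨ sdrA n k p r 2≤p p<m r<p ⟩
  prodAlong (sdrRHS n k p r) A  ≡⟨ prodAlong-cong (sdrRHS n k p r) A≗B ⟩
  prodAlong (sdrRHS n k p r) B  ∎

SDR-⊙ : ∀ {m A B} → SDR m A → SDR m B → SDR m (A ⊙ B)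
SDR-⊙ {A = A} {B} sdrA sdrB n k p r 2≤p p<m r<p = begin
  prodAlong L (A ⊙ B)            ≡⟨ prodAlong-⊙ L A B ⟩
  prodAlong L A * prodAlong L B  ≡⟨ cong₂ _*_ (sdrA n k p r 2≤p p<m r<p) (sdrB n k p r 2≤p p<m r<p) ⟩
  prodAlong R A * prodAlong R B  ≡⟨ prodAlong-⊙ R A B ⟨
  prodAlong R (A ⊙ B)            ∎
  where
  L = sdrLHS n k p r
  R = sdrRHS n k p r

SDR-cancel : ∀ {m A B} → (∀ n k → NonZero (B n k)) → SDR m (A ⊙ B) → SDR m B → SDR m A
SDR-cancel {A = A} {B} B≢0 sdrAB sdrB n k p r 2≤p p<m r<p =
  ℤ.*-cancelʳ-≡ (prodAlong L A) (prodAlong R A) (prodAlong L B) {{prodAlong-nonZero L {B} B≢0}} (begin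
    prodAlong L A * prodAlong L B  ≡⟨ prodAlong-⊙ L A B ⟨
    prodAlong L (A ⊙ B)            ≡⟨ sdrAB n k p r 2≤p p<m r<p ⟩
    prodAlong R (A ⊙ B)            ≡⟨ prodAlong-⊙ R A B ⟩
    prodAlong R A * prodAlong R B  ≡⟨ cong (prodAlong R A *_) (sdrB n k p r 2≤p p<m r<p) ⟨
    prodAlong R A * prodAlong L B  ∎)
  where
  L = sdrLHS n k p r
  R = sdrRHS n k p r

-- sdrLHS and sdrRHS for p = 1 + r + q, with p ∸ r and k + p ∸ r evaluated
zigLHS zigRHS : (n k r q : ℕ) → Zigzag
zigLHS n k r q = record
  { length₁ = suc r ; row₁ = λ i → n + i               ; col₁ = λ i → k + r ∸ i
  ; length₂ = suc q ; row₂ = λ i → n + suc (r + q) ∸ i ; col₂ = λ i → k + r + i + 1 }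
zigRHS n k r q = record
  { length₁ = suc r ; row₁ = λ i → n + suc (r + q) ∸ i ; col₁ = λ i → k + suc q + i
  ; length₂ = suc q ; row₂ = λ i → n + i               ; col₂ = λ i → k + suc q ∸ i ∸ 1 }

SDR-intro : ∀ {A} → (∀ n k r q → prodAlong (zigLHS n k r q) A ≡ prodAlong (zigRHS n k r q) A) →
  ∀ m → SDR m A
SDR-intro zig m n k zero    r () _ _
SDR-intro zig m n k (suc p) r _  _ r≤p with ℕ.m≤n⇒∃[o]m+o≡n r≤p
... | q , refl rewrite [1+m+n]∸m≡1+n r q
                     | ℕ.+-∸-assoc k (ℕ.m≤n⇒m≤1+n (ℕ.m≤m+n r q))
                     | [1+m+n]∸m≡1+n r q = zig n k r q

byRow byCol : (ℕ → ℤ) → Matrix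
byRow f n _ = f n
byCol f _ k = f k

byDiagonal : (ℤ → ℤ) → Matrix
byDiagonal f n k = f (n ⊖ k)

-- Both sides of the identity run through the rows n … n + p and the columns k … k + p exactly once.
byRow-SDR : ∀ f m → SDR m (byRow f)
byRow-SDR f = SDR-intro {byRow f} λ n k r q → begin
  prodTo (suc r) (λ i → f (n + i)) * prodTo (suc q) (λ i → f (n + suc (r + q) ∸ i))
    ≡⟨ cong (prodTo (suc r) (λ i → f (n + i)) *_) (prodTo-countdown (n + suc r) q f (regroup n r q)) ⟩
  prodTo (suc r) (λ i → f (n + i)) * prodTo (suc q) (λ i → f (n + suc r + i))
    ≡⟨ prodTo-swap n (suc r) (suc q) f ⟩
  prodTo (suc r) (λ i → f (n + suc q + i)) * prodTo (suc q) (λ i → f (n + i))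
    ≡⟨ cong (_* prodTo (suc q) (λ i → f (n + i))) (prodTo-countdown (n + suc q) r f (regroup′ n r q)) ⟨
  prodTo (suc r) (λ i → f (n + suc (r + q) ∸ i)) * prodTo (suc q) (λ i → f (n + i))
    ∎
  where
  regroup : ∀ n r q → n + suc (r + q) ≡ n + suc r + q
  regroup = ℕ-Solver.solve-∀
  regroup′ : ∀ n r q → n + suc (r + q) ≡ n + suc q + r
  regroup′ = ℕ-Solver.solve-∀

byCol-SDR : ∀ f m → SDR m (byCol f)
byCol-SDR f = SDR-intro {byCol f} λ n k r q → begin
  prodTo (suc r) (λ i → f (k + r ∸ i)) * prodTo (suc q) (λ i → f (k + r + i + 1))
    ≡⟨ cong₂ _*_ (prodTo-countdown k r f refl) (prodTo-cong (suc q) (λ i _ → cong f (regroup k r i))) ⟩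
  prodTo (suc r) (λ i → f (k + i)) * prodTo (suc q) (λ i → f (k + suc r + i))
    ≡⟨ prodTo-swap k (suc r) (suc q) f ⟩
  prodTo (suc r) (λ i → f (k + suc q + i)) * prodTo (suc q) (λ i → f (k + i))
    ≡⟨ cong (prodTo (suc r) (λ i → f (k + suc q + i)) *_)
            (prodTo-countdown (suc k) q (λ x → f (x ∸ 1)) (ℕ.+-suc k q)) ⟨
  prodTo (suc r) (λ i → f (k + suc q + i)) * prodTo (suc q) (λ i → f (k + suc q ∸ i ∸ 1))
    ∎
  where
  regroup : ∀ k r i → k + r + i + 1 ≡ k + suc r + i
  regroup = ℕ-Solver.solve-∀

-- The i-th cell of the first run of each side lies on the same diagonal as the (r − i)-th cell
-- of the first run of the other side; likewise for the second runs with q − i.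
byDiagonal-SDR : ∀ f m → SDR m (byDiagonal f)
byDiagonal-SDR f = SDR-intro {byDiagonal f} zigzag
  where
  zigzag : ∀ n k r q →
    prodAlong (zigLHS n k r q) (byDiagonal f) ≡ prodAlong (zigRHS n k r q) (byDiagonal f)
  zigzag n k r q = cong₂ _*_
    (trans (prodTo-reverse (suc r) _)
           (prodTo-cong (suc r) λ i i<1+r → cong f (first (ℕ.≤-pred i<1+r))))
    (sym (trans (prodTo-reverse (suc q) _)
                (prodTo-cong (suc q) λ i i<1+q → cong f (second (ℕ.≤-pred i<1+q)))))
    where
    first : ∀ {i} → i ≤ r →
      (n + (r ∸ i)) ⊖ (k + r ∸ (r ∸ i)) ≡ (n + suc (r + q) ∸ i) ⊖ (k + suc q + i)
    first {i} i≤r = begin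
      (n + (r ∸ i)) ⊖ (k + r ∸ (r ∸ i))
        ≡⟨ cong ((n + (r ∸ i)) ⊖_) ([m+n]∸[n∸o]≡m+o k i≤r) ⟩
      (n + (r ∸ i)) ⊖ (k + i)
        ≡⟨ m+q≡o+n⇒m⊖n≡o⊖q {n + (r ∸ i)} (shift n k q i (r ∸ i)) ⟩
      (n + suc q + (r ∸ i)) ⊖ (k + suc q + i)
        ≡⟨ cong (_⊖ (k + suc q + i)) row ⟨
      (n + suc (r + q) ∸ i) ⊖ (k + suc q + i)
        ∎
      where
      shift : ∀ n k q i x → n + x + (k + suc q + i) ≡ n + suc q + x + (k + i)
      shift = ℕ-Solver.solve-∀
      regroup : ∀ n r q → n + suc (r + q) ≡ n + suc q + r
      regroup = ℕ-Solver.solve-∀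
      row : n + suc (r + q) ∸ i ≡ n + suc q + (r ∸ i)
      row = trans (cong (_∸ i) (regroup n r q)) (ℕ.+-∸-assoc (n + suc q) i≤r)
    second : ∀ {i} → i ≤ q →
      (n + (q ∸ i)) ⊖ (k + suc q ∸ (q ∸ i) ∸ 1) ≡ (n + suc (r + q) ∸ i) ⊖ (k + r + i + 1)
    second {i} i≤q = begin
      (n + (q ∸ i)) ⊖ (k + suc q ∸ (q ∸ i) ∸ 1)
        ≡⟨ cong (λ x → (n + (q ∸ i)) ⊖ (x ∸ 1)) col ⟩
      (n + (q ∸ i)) ⊖ (k + i)
        ≡⟨ m+q≡o+n⇒m⊖n≡o⊖q {n + (q ∸ i)} (shift n k r i (q ∸ i)) ⟩
      (n + suc r + (q ∸ i)) ⊖ (k + r + i + 1)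
        ≡⟨ cong (_⊖ (k + r + i + 1)) row ⟨
      (n + suc (r + q) ∸ i) ⊖ (k + r + i + 1)
        ∎
      where
      shift : ∀ n k r i x → n + x + (k + r + i + 1) ≡ n + suc r + x + (k + i)
      shift = ℕ-Solver.solve-∀
      regroup : ∀ n r q → n + suc (r + q) ≡ n + suc r + q
      regroup = ℕ-Solver.solve-∀
      col : k + suc q ∸ (q ∸ i) ≡ suc k + i
      col = trans (cong (_∸ (q ∸ i)) (ℕ.+-suc k q)) ([m+n]∸[n∸o]≡m+o (suc k) i≤q)
      row : n + suc (r + q) ∸ i ≡ n + suc r + (q ∸ i)
      row = trans (cong (_∸ i) (regroup n r q)) (ℕ.+-∸-assoc (n + suc r) i≤q)

record ProductForm (A : Matrix) : Set where
  field
    row col     : ℕ → ℤ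
    num den     : ℤ → ℤ
    col-nonZero : ∀ k → NonZero (col k)
    den-nonZero : ∀ d → NonZero (den d)
    factorise   : ∀ n k → A n k * (col k * den (n ⊖ k)) ≡ row n * num (n ⊖ k)

productForm⇒SDR : ∀ {A} → ProductForm A → ∀ m → SDR m A
productForm⇒SDR {A} pf m =
  SDR-cancel {m} {A} {byCol col ⊙ byDiagonal den} denominator≢0
    (SDR-cong {m} {byRow row ⊙ byDiagonal num} (λ n k → sym (factorise n k)) numerator)
    denominator
  where
  open ProductForm pf
  numerator : SDR m (byRow row ⊙ byDiagonal num)
  numerator = SDR-⊙ {m} {byRow row} {byDiagonal num} (byRow-SDR row m) (byDiagonal-SDR num m)
  denominator : SDR m (byCol col ⊙ byDiagonal den)
  denominator = SDR-⊙ {m} {byCol col} {byDiagonal den} (byCol-SDR col m) (byDiagonal-SDR den m)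
  denominator≢0 : ∀ n k → NonZero (col k * den (n ⊖ k))
  denominator≢0 n k = ℤ.i*j≢0 (col k) (den (n ⊖ k)) {{col-nonZero k}} {{den-nonZero (n ⊖ k)}}

sumFin-cong : ∀ {j} {f g : Fin j → ℤ} → (∀ i → f i ≡ g i) → sumFin f ≡ sumFin g
sumFin-cong {zero}  f≗g = refl
sumFin-cong {suc j} f≗g = cong₂ ℤ._+_ (f≗g zero) (sumFin-cong (λ i → f≗g (suc i)))

sumFin-*ˡ : ∀ {j} x (f : Fin j → ℤ) → sumFin (λ i → x * f i) ≡ x * sumFin f
sumFin-*ˡ {zero}  x f = sym (ℤ.*-zeroʳ x)
sumFin-*ˡ {suc j} x f =
  trans (cong (ℤ._+_ (x * f zero)) (sumFin-*ˡ x (λ i → f (suc i))))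
        (sym (ℤ.*-distribˡ-+ x (f zero) (sumFin (λ i → f (suc i)))))

∏-nonZero : ∀ {j} (x : Fin j → ℤ) → (∀ i → NonZero (x i)) → NonZero (∏ x)
∏-nonZero {zero}  _ _   = _
∏-nonZero {suc j} x x≢0 = ℤ.i*j≢0 (x zero) (∏ (λ i → x (suc i)))
  {{x≢0 zero}} {{∏-nonZero (λ i → x (suc i)) (λ i → x≢0 (suc i))}}

det-cong : ∀ j {M N : Fin j → Fin j → ℤ} → (∀ s t → M s t ≡ N s t) → det j M ≡ det j N
det-cong zero    M≗N = refl
det-cong (suc j) M≗N = sumFin-cong λ c →
  cong₂ _*_ (cong (sign (toℕ c) *_) (M≗N zero c)) (det-cong j (λ s t → M≗N (suc s) (punchIn c t)))

private
  pull-out : ∀ σ x m p d → σ * (x * m) * (p * d) ≡ (x * p) * (σ * m * d)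
  pull-out = ℤ-Solver.solve-∀

det-scale-rows : ∀ j (x : Fin j → ℤ) (M : Fin j → Fin j → ℤ) →
  det j (λ s t → x s * M s t) ≡ ∏ x * det j M
det-scale-rows zero    x M = refl
det-scale-rows (suc j) x M = begin
  sumFin (λ c → sign (toℕ c) * (x zero * M zero c) * det j (λ s t → x (suc s) * minor c s t))
    ≡⟨ sumFin-cong (λ c → cong (sign (toℕ c) * (x zero * M zero c) *_)
                                (det-scale-rows j (λ s → x (suc s)) (minor c))) ⟩
  sumFin (λ c → sign (toℕ c) * (x zero * M zero c) * (rest * det j (minor c)))
    ≡⟨ sumFin-cong (λ c → pull-out (sign (toℕ c)) (x zero) (M zero c) rest (det j (minor c))) ⟩
  sumFin (λ c → ∏ x * term c)
    ≡⟨ sumFin-*ˡ (∏ x) term ⟩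
  ∏ x * det (suc j) M
    ∎
  where
  minor : Fin (suc j) → Fin j → Fin j → ℤ
  minor c s t = M (suc s) (punchIn c t)
  term : Fin (suc j) → ℤ
  term c = sign (toℕ c) * M zero c * det j (minor c)
  rest : ℤ
  rest = ∏ (λ s → x (suc s))

det-scale-cols : ∀ j (y : Fin j → ℤ) (M : Fin j → Fin j → ℤ) →
  det j (λ s t → y t * M s t) ≡ ∏ y * det j M
det-scale-cols zero    y M = refl
det-scale-cols (suc j) y M = begin
  sumFin (λ c → sign (toℕ c) * (y c * M zero c) * det j (λ s t → y (punchIn c t) * minor c s t))
    ≡⟨ sumFin-cong (λ c → cong (sign (toℕ c) * (y c * M zero c) *_)
                                (det-scale-cols j (λ t → y (punchIn c t)) (minor c))) ⟩
  sumFin (λ c → sign (toℕ c) * (y c * M zero c) * (rest c * det j (minor c)))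
    ≡⟨ sumFin-cong (λ c → trans (pull-out (sign (toℕ c)) (y c) (M zero c) (rest c) (det j (minor c)))
                                (cong (_* term c) (sym (sum-remove y)))) ⟩
  sumFin (λ c → ∏ y * term c)
    ≡⟨ sumFin-*ˡ (∏ y) term ⟩
  ∏ y * det (suc j) M
    ∎
  where
  minor : Fin (suc j) → Fin j → Fin j → ℤ
  minor c s t = M (suc s) (punchIn c t)
  term : Fin (suc j) → ℤ
  term c = sign (toℕ c) * M zero c * det j (minor c)
  rest : Fin (suc j) → ℤ
  rest c = ∏ (λ t → y (punchIn c t))

module Minors (j : ℕ) (A : Matrix) (α β γ : ℕ → ℤ) (G : ℕ → ℕ → ℤ)
  (β-nonZero : ∀ k → NonZero (β k)) (γ-nonZero : ∀ e → NonZero (γ e))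
  (A-upper : ∀ {n k} → n < k → A n k ≡ 0ℤ)
  (A-lower : ∀ {n k} → k ≤ n → A n k * (β k * γ (n ∸ k)) ≡ α n)
  (G-upper : ∀ {m t} → m < t → G m t ≡ 0ℤ)
  (G-lower : ∀ {m t} → t ≤ m → G m t * γ (m ∸ t) ≡ γ m)
  where

  scaled-entry : ∀ k d s t →
    γ (d + s) * (β (k + t) * A (k + d + s) (k + t)) ≡ α (k + d + s) * G (d + s) t
  scaled-entry k d s t with t ℕ.≤? d + s
  ... | yes t≤d+s = begin
    γ (d + s) * (β K * A N K)                ≡⟨ cong (_* (β K * A N K)) (G-lower t≤d+s) ⟨
    G (d + s) t * γ (d + s ∸ t) * (β K * A N K)
      ≡⟨ cong (λ e → G (d + s) t * γ e * (β K * A N K)) N∸K≡d+s∸t ⟨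
    G (d + s) t * γ (N ∸ K) * (β K * A N K)  ≡⟨ rearrange (G (d + s) t) (γ (N ∸ K)) (β K) (A N K) ⟩
    A N K * (β K * γ (N ∸ K)) * G (d + s) t  ≡⟨ cong (_* G (d + s) t) (A-lower K≤N) ⟩
    α N * G (d + s) t                        ∎
    where
    N = k + d + s
    K = k + t
    K≤N : K ≤ N
    K≤N = subst (K ≤_) (sym (ℕ.+-assoc k d s)) (ℕ.+-monoʳ-≤ k t≤d+s)
    N∸K≡d+s∸t : N ∸ K ≡ d + s ∸ t
    N∸K≡d+s∸t = trans (cong (_∸ K) (ℕ.+-assoc k d s)) (ℕ.[m+n]∸[m+o]≡n∸o k (d + s) t)
    rearrange : ∀ g c b a → g * c * (b * a) ≡ a * (b * c) * g
    rearrange = ℤ-Solver.solve-∀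
  ... | no t≰d+s = begin
    γ (d + s) * (β (k + t) * A (k + d + s) (k + t))
      ≡⟨ cong (λ a → γ (d + s) * (β (k + t) * a)) (A-upper N<K) ⟩
    γ (d + s) * (β (k + t) * 0ℤ)
      ≡⟨ cong (γ (d + s) *_) (ℤ.*-zeroʳ (β (k + t))) ⟩
    γ (d + s) * 0ℤ
      ≡⟨ ℤ.*-zeroʳ (γ (d + s)) ⟩
    0ℤ
      ≡⟨ ℤ.*-zeroʳ (α (k + d + s)) ⟨
    α (k + d + s) * 0ℤ
      ≡⟨ cong (α (k + d + s) *_) (G-upper (ℕ.≰⇒> t≰d+s)) ⟨
    α (k + d + s) * G (d + s) t
      ∎
    where
    N<K : k + d + s < k + t
    N<K = subst (_< k + t) (sym (ℕ.+-assoc k d s)) (ℕ.+-monoʳ-< k (ℕ.≰⇒> t≰d+s))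

  row col : ℕ → ℤ
  row n = ∏ (λ (s : Fin j) → α (n + toℕ s))
  col k = ∏ (λ (t : Fin j) → β (k + toℕ t))

  num den : ℤ → ℤ
  num (+ d)    = det j (λ s t → G (d + toℕ s) (toℕ t))
  num -[1+ _ ] = 0ℤ
  den (+ d)    = ∏ (λ (s : Fin j) → γ (d + toℕ s))
  den -[1+ _ ] = 1ℤ

  -- Scaling row s of the minor by γ (d + s) and column t by β (k + t) gives the matrix
  -- (α (k + d + s) G (d + s) t), whose rows have the common factors α (k + d + s).
  minor-factorise : ∀ k d →
    det j (λ s t → A (k + d + toℕ s) (k + toℕ t)) * (col k * den (+ d)) ≡ row (k + d) * num (+ d)
  minor-factorise k d = begin
    det j M * (col k * den (+ d))
      ≡⟨ swap (det j M) (col k) (den (+ d)) ⟩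
    den (+ d) * (col k * det j M)
      ≡⟨ cong (den (+ d) *_) (det-scale-cols j _ M) ⟨
    den (+ d) * det j (λ s t → β (k + toℕ t) * M s t)
      ≡⟨ det-scale-rows j _ _ ⟨
    det j (λ s t → γ (d + toℕ s) * (β (k + toℕ t) * M s t))
      ≡⟨ det-cong j (λ s t → scaled-entry k d (toℕ s) (toℕ t)) ⟩
    det j (λ s t → α (k + d + toℕ s) * G (d + toℕ s) (toℕ t))
      ≡⟨ det-scale-rows j _ _ ⟩
    row (k + d) * num (+ d)
      ∎
    where
    M : Fin j → Fin j → ℤ
    M s t = A (k + d + toℕ s) (k + toℕ t)
    swap : ∀ a b c → a * (b * c) ≡ c * (b * a)
    swap = ℤ-Solver.solve-∀

  minorMatrix-productForm : ProductForm (minorMatrix j A)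
  minorMatrix-productForm = record
    { row = row ; col = col ; num = num ; den = den
    ; col-nonZero = λ k → ∏-nonZero (λ (t : Fin j) → β (k + toℕ t)) (λ t → β-nonZero (k + toℕ t))
    ; den-nonZero = den-nonZero
    ; factorise   = factorise
    }
    where
    den-nonZero : ∀ d → NonZero (den d)
    den-nonZero (+ d)    = ∏-nonZero (λ (s : Fin j) → γ (d + toℕ s)) (λ s → γ-nonZero (d + toℕ s))
    den-nonZero -[1+ _ ] = _
    factorise : ∀ n k → minorMatrix j A n k * (col k * den (n ⊖ k)) ≡ row n * num (n ⊖ k)
    factorise n k with ℕ.≤-<-connex k n
    ... | inj₁ k≤n with ℕ.m≤n⇒∃[o]m+o≡n k≤n
    ...   | d , refl = begin
      minorMatrix j A (k + d) k * (col k * den ((k + d) ⊖ k))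
        ≡⟨ cong₂ (λ a z → a * (col k * den z)) (lowerTri-≤ _ k≤n) ([m+n]⊖m≡n k d) ⟩
      det j (λ s t → A (k + d + toℕ s) (k + toℕ t)) * (col k * den (+ d))
        ≡⟨ minor-factorise k d ⟩
      row (k + d) * num (+ d)
        ≡⟨ cong (λ z → row (k + d) * num z) ([m+n]⊖m≡n k d) ⟨
      row (k + d) * num ((k + d) ⊖ k)
        ∎
    factorise n k | inj₂ n<k with m<n⇒⊖-negative n<k
    ... | x , n⊖k≡-[1+x] = begin
      minorMatrix j A n k * scale  ≡⟨ cong (_* scale) (lowerTri-> _ n<k) ⟩
      0ℤ * scale                   ≡⟨ ℤ.*-zeroˡ scale ⟩
      0ℤ                           ≡⟨ ℤ.*-zeroʳ (row n) ⟨
      row n * num -[1+ x ]         ≡⟨ cong (λ z → row n * num z) n⊖k≡-[1+x] ⟨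
      row n * num (n ⊖ k)          ∎
      where scale = col k * den (n ⊖ k)

  minorMatrix-SDR∞ : SDR∞ (minorMatrix j A)
  minorMatrix-SDR∞ m _ = productForm⇒SDR minorMatrix-productForm m

module NaturalMinors (j : ℕ) (f : ℕ → ℕ → ℕ) (α β γ : ℕ → ℕ) (G : ℕ → ℕ → ℕ)
  (β-nonZero : ∀ k → ℕ.NonZero (β k)) (γ-nonZero : ∀ e → ℕ.NonZero (γ e))
  (f-lower : ∀ {n k} → k ≤ n → f n k ℕ.* (β k ℕ.* γ (n ∸ k)) ≡ α n)
  (G-upper : ∀ {m t} → m < t → G m t ≡ 0)
  (G-lower : ∀ {m t} → t ≤ m → G m t ℕ.* γ (m ∸ t) ≡ γ m)
  where

  private
    F : Matrix
    F = lowerTri (λ n k → + f n k)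

    F-lower : ∀ {n k} → k ≤ n → F n k * (+ β k * + γ (n ∸ k)) ≡ + α n
    F-lower {n} {k} k≤n = begin
      F n k * (+ β k * + γ (n ∸ k))
        ≡⟨ cong₂ _*_ (lowerTri-≤ _ k≤n) (sym (ℤ.pos-* (β k) (γ (n ∸ k)))) ⟩
      + f n k * + (β k ℕ.* γ (n ∸ k))
        ≡⟨ ℤ.pos-* (f n k) _ ⟨
      + (f n k ℕ.* (β k ℕ.* γ (n ∸ k)))
        ≡⟨ cong +_ (f-lower k≤n) ⟩
      + α n
        ∎

  open Minors j F (λ n → + α n) (λ k → + β k) (λ e → + γ e) (λ m t → + G m t)
    β-nonZero γ-nonZero (lowerTri-> _) F-lower (λ m<t → cong +_ (G-upper m<t))
    (λ {m} {t} t≤m → trans (sym (ℤ.pos-* (G m t) (γ (m ∸ t)))) (cong +_ (G-lower t≤m)))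
    public using (minorMatrix-SDR∞)

minorMatrix-𝒫-SDR∞ : ∀ j → SDR∞ (minorMatrix j 𝒫)
minorMatrix-𝒫-SDR∞ j = NaturalMinors.minorMatrix-SDR∞ j (λ n k → n C k) _! _! _! _P_
  _!≢0 _!≢0 nCk*k!*[n∸k]!≡n! k>n⇒nPk≡0 nPk*[n∸k]!≡n!

minorMatrix-𝒩-SDR∞ : ∀ j → SDR∞ (minorMatrix j 𝒩)
minorMatrix-𝒩-SDR∞ j = NaturalMinors.minorMatrix-SDR∞ j narayana
  (λ n → n ! ℕ.* suc n !) (λ k → k ! ℕ.* suc k !) (λ e → e ! ℕ.* suc e !)
  (λ m t → (m P t) ℕ.* (suc m P t))
  (λ k → k !* suc k !≢0) (λ e → e !* suc e !≢0) narayana-factorial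
  (λ {m} {t} m<t → cong (ℕ._* (suc m P t)) (k>n⇒nPk≡0 m<t)) nPk*[1+n]Pk*[n∸k]!*[1+n∸k]!≡n!*[1+n]!

minorMatrix-ℒ-SDR∞ : ∀ j → SDR∞ (minorMatrix j ℒ)
minorMatrix-ℒ-SDR∞ j = NaturalMinors.minorMatrix-SDR∞ j lah
  (λ n → n ! ℕ.* suc n !) (λ k → k ! ℕ.* suc k !) _! _P_
  (λ k → k !* suc k !≢0) _!≢0 lah-factorial k>n⇒nPk≡0 nPk*[n∸k]!≡n!

corollary2p2 : ∀ (j : ℕ) → 1 ≤ j →
    SDR∞ (minorMatrix j 𝒫) × SDR∞ (minorMatrix j 𝒩) × SDR∞ (minorMatrix j ℒ)
corollary2p2 j _ = minorMatrix-𝒫-SDR∞ j , minorMatrix-𝒩-SDR∞ j , minorMatrix-ℒ-SDR∞ j
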